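{- Let $K$ be a field with $\mathrm{char}(K)\ne2,3$, $\Delta\in K^*$, $L=K[\delta]$ with $\delta^2=-3\Delta$, and let $g\in K[X,Y]$ be a binary cubic form of discriminant $\Delta$ with Cardano covariant $C(X,Y)=c_0X^3+c_1X^2Y+c_2XY^2+c_3Y^3\in L[X,Y]$. Define $F\in L[X_1,Y_1,X_2,Y_2]$ by $3F=(3c_0X_1^2+2c_1X_1Y_1+c_2Y_1^2)X_2+(c_1X_1^2+2c_2X_1Y_1+3c_3Y_1^2)Y_2$. Then $C(X_1,Y_1)^2C(X_2,Y_2)=F(X_1,Y_1,X_2,Y_2)^3$.
   Context: For $g=aX^3+bX^2Y+cXY^2+dY^3$: discriminant $b^2c^2-4ac^3-4b^3d-27a^2d^2+18abcd$; cubic covariant $G(X,Y)=(2b^3+27a^2d-9abc)X^3+3(b^2c+9abd-6ac^2)X^2Y-3(bc^2+9acd-6b^2d)XY^2-(2c^3+27ad^2-9bcd)Y^3$. $L=K[T]/(T^2+3\Delta)$ and $\delta$ is the image of $T$. The Cardano covariant is $C=\tfrac12(G+3\delta g)$. -}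

module Defs where

open import Level using (Level; _⊔_)
open import Data.Nat using (ℕ; zero; suc)
open import Data.Product using (Σ; proj₁)
open import Relation.Nullary using (¬_)
open import Algebra.Bundles using (CommutativeRing)

record IsField {k ℓ : Level} (K : CommutativeRing k ℓ) : Set (k ⊔ ℓ) where
  open CommutativeRing K
  field
    1≉0 : ¬ (1# ≈ 0#)
    inv : (x : Carrier) → ¬ (x ≈ 0#) → Σ Carrier (λ y → x * y ≈ 1#)

module _ {k ℓ : Level} (K : CommutativeRing k ℓ) where
  open CommutativeRing K

  num : ℕ → Carrier
  num zero = 0#
  num (suc n) = 1# + num n

  infixl 6 _−_
  _−_ : Carrier → Carrier → Carrier
  x − y = x + (- y)

  cube : Carrier → Carrier
  cube x = x * x * x

  sq : Carrier → Carrier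
  sq x = x * x

  disc : Carrier → Carrier → Carrier → Carrier → Carrier
  disc a b c d =
    sq b * sq c − num 4 * a * cube c − num 4 * cube b * d
      − num 27 * sq a * sq d + num 18 * a * b * c * d

  G0 G1 G2 G3 : Carrier → Carrier → Carrier → Carrier → Carrier
  G0 a b c d = num 2 * cube b + num 27 * sq a * d − num 9 * a * b * c
  G1 a b c d = num 3 * (sq b * c + num 9 * a * b * d − num 6 * a * sq c)
  G2 a b c d = - (num 3 * (b * sq c + num 9 * a * c * d − num 6 * sq b * d))
  G3 a b c d = - (num 2 * cube c + num 27 * a * sq d − num 9 * b * c * d)

-- Polynomial identities over L = K[T]/(T^2 + 3Δ) in the variables
-- X1,Y1,X2,Y2 are expressed by evaluation in an arbitrary commutative
-- L-algebra R, i.e. a commutative ring R with a ring homomorphism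
-- ι : K → R and an element δ ∈ R with δ^2 = -3 ι(Δ).  (Taking
-- R = L[X1,Y1,X2,Y2] recovers the polynomial identity.)
module _ {k ℓ r ℓr : Level} (K : CommutativeRing k ℓ) (Kf : IsField K)
         (R : CommutativeRing r ℓr)
         (ι : CommutativeRing.Carrier K → CommutativeRing.Carrier R)
         (δ : CommutativeRing.Carrier R) where
  private
    module K = CommutativeRing K
    module R = CommutativeRing R
  open R

  half : ¬ (num K 2 K.≈ K.0#) → K.Carrier
  half ch2 = proj₁ (IsField.inv Kf (num K 2) ch2)

  third : ¬ (num K 3 K.≈ K.0#) → K.Carrier
  third ch3 = proj₁ (IsField.inv Kf (num K 3) ch3)

  c0 c1 c2 c3 : ¬ (num K 2 K.≈ K.0#) → (a b c d : K.Carrier) → Carrier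
  c0 ch2 a b c d = ι (half ch2) * (ι (G0 K a b c d) + num R 3 * δ * ι a)
  c1 ch2 a b c d = ι (half ch2) * (ι (G1 K a b c d) + num R 3 * δ * ι b)
  c2 ch2 a b c d = ι (half ch2) * (ι (G2 K a b c d) + num R 3 * δ * ι c)
  c3 ch2 a b c d = ι (half ch2) * (ι (G3 K a b c d) + num R 3 * δ * ι d)

  cardano : ¬ (num K 2 K.≈ K.0#) → (a b c d : K.Carrier) → Carrier → Carrier → Carrier
  cardano ch2 a b c d x y =
    c0 ch2 a b c d * cube R x + c1 ch2 a b c d * sq R x * y
      + c2 ch2 a b c d * x * sq R y + c3 ch2 a b c d * cube R y

  Fform : ¬ (num K 2 K.≈ K.0#) → ¬ (num K 3 K.≈ K.0#) → (a b c d : K.Carrier) →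
          Carrier → Carrier → Carrier → Carrier → Carrier
  Fform ch2 ch3 a b c d x1 y1 x2 y2 =
    ι (third ch3) *
      ((num R 3 * c0 ch2 a b c d * sq R x1 + num R 2 * c1 ch2 a b c d * x1 * y1
          + c2 ch2 a b c d * sq R y1) * x2
       + (c1 ch2 a b c d * sq R x1 + num R 2 * c2 ch2 a b c d * x1 * y1
          + num R 3 * c3 ch2 a b c d * sq R y1) * y2)

{-# OPTIONS --safe #-}
-- The Cardano covariant C = (G + 3δg)/2 has vanishing Hessian: the Hessian of the cubic
-- covariant is Hess G = 27Δ Hess g, the mixed Hessian of G and g vanishes, and (3δ)² = -27Δ.
-- A binary cubic f with vanishing Hessian is a cube of its own polar up to the factor 27,
-- 27 f(P₁)² f(P₂) = (∇f(P₁)·P₂)³, since coefficientwise 27 f(P)² c_i = (3 choose i) ∂_X f(P)^(3-i) ∂_Y f(P)^i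
-- modulo the Hessian coefficients. Dividing by 27 = 3³ gives C(P₁)² C(P₂) = F³ with 3F = ∇C(P₁)·P₂.
module Submission where

open import Level using (Level; _⊔_)
open import Algebra.Bundles using (CommutativeRing)
open import Algebra.Bundles.Raw using (RawRing)
open import Algebra.Morphism.Structures using (module RingMorphisms)
open import Algebra.Solver.Ring.AlmostCommutativeRing
  using (_-Raw-AlmostCommutative⟶_; fromCommutativeRing)
open import Data.Fin.Base using (Fin)
open import Data.Fin.Patterns using (0F; 1F; 2F)
open import Data.Integer.Base as ℤ using (ℤ; +_; -[1+_]; _⊖_; sign; ∣_∣; _◃_)
import Data.Integer.Properties as ℤ
import Data.Maybe.Base as Maybe
open import Data.Nat.Base as ℕ using (ℕ; zero; suc)
import Data.Nat.Properties as ℕ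
open import Data.Product.Base using (_×_; proj₂)
open import Data.Sign.Base as Sign using (Sign)
open import Relation.Binary.Consequences using (dec⇒weaklyDec)
open import Relation.Binary.PropositionalEquality.Core as ≡ using (_≡_)
open import Relation.Nullary using (¬_)
open import Defs

module IntegerCoefficientSolver {r ℓ} (R : CommutativeRing r ℓ) where
  open CommutativeRing R
  open import Algebra.Properties.Ring ring
  open import Relation.Binary.Reasoning.Setoid setoid

  -- On naturals fromℤ is num, so solver constants con (+ n) denote the numerals num R n.
  fromℤ : ℤ → Carrier
  fromℤ (+ n)    = num R n
  fromℤ -[1+ n ] = - num R (suc n)

  private
    num-+ : ∀ m n → num R (m ℕ.+ n) ≈ num R m + num R n
    num-+ zero    n = sym (+-identityˡ _)
    num-+ (suc m) n = trans (+-congˡ (num-+ m n)) (sym (+-assoc _ _ _))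

    num-* : ∀ m n → num R (m ℕ.* n) ≈ num R m * num R n
    num-* zero    n = sym (zeroˡ _)
    num-* (suc m) n = begin
      num R (n ℕ.+ m ℕ.* n)          ≈⟨ num-+ n (m ℕ.* n) ⟩
      num R n + num R (m ℕ.* n)      ≈⟨ +-cong (sym (*-identityˡ _)) (num-* m n) ⟩
      1# * num R n + num R m * num R n ≈⟨ distribʳ _ _ _ ⟨
      (1# + num R m) * num R n       ∎

    [1+x]-[1+y]≈x-y : ∀ x y → (1# + x) - (1# + y) ≈ x - y
    [1+x]-[1+y]≈x-y x y = begin
      (1# + x) - (1# + y)    ≈⟨ +-congˡ (-‿+-comm 1# y) ⟨
      (1# + x) + (- 1# - y)  ≈⟨ +-congʳ (+-comm 1# x) ⟩
      (x + 1#) + (- 1# - y)  ≈⟨ +-assoc x 1# _ ⟩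
      x + (1# + (- 1# - y))  ≈⟨ +-congˡ (+-assoc 1# (- 1#) (- y)) ⟨
      x + ((1# - 1#) - y)    ≈⟨ +-congˡ (+-congʳ (-‿inverseʳ 1#)) ⟩
      x + (0# - y)           ≈⟨ +-congˡ (+-identityˡ (- y)) ⟩
      x - y                  ∎

    fromℤ-⊖ : ∀ m n → fromℤ (m ⊖ n) ≈ num R m - num R n
    fromℤ-⊖ zero    zero    = sym (-‿inverseʳ 0#)
    fromℤ-⊖ zero    (suc n) = sym (+-identityˡ _)
    fromℤ-⊖ (suc m) zero    = sym (trans (+-congˡ -0#≈0#) (+-identityʳ _))
    fromℤ-⊖ (suc m) (suc n) = begin
      fromℤ (suc m ⊖ suc n)  ≡⟨ ≡.cong fromℤ (ℤ.[1+m]⊖[1+n]≡m⊖n m n) ⟩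
      fromℤ (m ⊖ n)          ≈⟨ fromℤ-⊖ m n ⟩
      num R m - num R n      ≈⟨ [1+x]-[1+y]≈x-y (num R m) (num R n) ⟨
      num R (suc m) - num R (suc n) ∎

    fromℤ-+ : ∀ i j → fromℤ (i ℤ.+ j) ≈ fromℤ i + fromℤ j
    fromℤ-+ (+ m)    (+ n)    = num-+ m n
    fromℤ-+ (+ m)    -[1+ n ] = fromℤ-⊖ m (suc n)
    fromℤ-+ -[1+ m ] (+ n)    = trans (fromℤ-⊖ n (suc m)) (+-comm _ _)
    fromℤ-+ -[1+ m ] -[1+ n ] = begin
      - num R (suc (suc (m ℕ.+ n)))       ≡⟨ ≡.cong (λ k → - num R (suc k)) (ℕ.+-suc m n) ⟨
      - num R (suc m ℕ.+ suc n)           ≈⟨ -‿cong (num-+ (suc m) (suc n)) ⟩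
      - (num R (suc m) + num R (suc n))   ≈⟨ -‿+-comm _ _ ⟨
      - num R (suc m) - num R (suc n)     ∎

    signed : Sign → Carrier → Carrier
    signed Sign.+ x = x
    signed Sign.- x = - x

    signed-cong : ∀ s {x y} → x ≈ y → signed s x ≈ signed s y
    signed-cong Sign.+ x≈y = x≈y
    signed-cong Sign.- x≈y = -‿cong x≈y

    signed-* : ∀ s t x y → signed (s Sign.* t) (x * y) ≈ signed s x * signed t y
    signed-* Sign.+ Sign.+ x y = refl
    signed-* Sign.+ Sign.- x y = -‿distribʳ-* x y
    signed-* Sign.- Sign.+ x y = -‿distribˡ-* x y
    signed-* Sign.- Sign.- x y = begin
      x * y          ≈⟨ -‿involutive (x * y) ⟨
      - - (x * y)    ≈⟨ -‿cong (-‿distribˡ-* x y) ⟩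
      - (- x * y)    ≈⟨ -‿distribʳ-* (- x) y ⟩
      - x * - y      ∎

    fromℤ-◃ : ∀ s n → fromℤ (s ◃ n) ≈ signed s (num R n)
    fromℤ-◃ Sign.+ zero    = refl
    fromℤ-◃ Sign.- zero    = sym -0#≈0#
    fromℤ-◃ Sign.+ (suc n) = refl
    fromℤ-◃ Sign.- (suc n) = refl

    fromℤ≈signed : ∀ i → fromℤ i ≈ signed (sign i) (num R ∣ i ∣)
    fromℤ≈signed (+ n)    = refl
    fromℤ≈signed -[1+ n ] = refl

    fromℤ-* : ∀ i j → fromℤ (i ℤ.* j) ≈ fromℤ i * fromℤ j
    fromℤ-* i j = begin
      fromℤ ((sign i Sign.* sign j) ◃ (∣ i ∣ ℕ.* ∣ j ∣))
        ≈⟨ fromℤ-◃ (sign i Sign.* sign j) (∣ i ∣ ℕ.* ∣ j ∣) ⟩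
      signed (sign i Sign.* sign j) (num R (∣ i ∣ ℕ.* ∣ j ∣))
        ≈⟨ signed-cong (sign i Sign.* sign j) (num-* ∣ i ∣ ∣ j ∣) ⟩
      signed (sign i Sign.* sign j) (num R ∣ i ∣ * num R ∣ j ∣)
        ≈⟨ signed-* (sign i) (sign j) _ _ ⟩
      signed (sign i) (num R ∣ i ∣) * signed (sign j) (num R ∣ j ∣)
        ≈⟨ *-cong (fromℤ≈signed i) (fromℤ≈signed j) ⟨
      fromℤ i * fromℤ j ∎

    fromℤ-neg : ∀ i → fromℤ (ℤ.- i) ≈ - fromℤ i
    fromℤ-neg (+ zero)  = sym -0#≈0#
    fromℤ-neg (+ suc n) = refl
    fromℤ-neg -[1+ n ]  = sym (-‿involutive _)

  fromℤ-homomorphism : ℤ.+-*-rawRing -Raw-AlmostCommutative⟶ fromCommutativeRing R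
  fromℤ-homomorphism = record
    { ⟦_⟧    = fromℤ
    ; +-homo = fromℤ-+
    ; *-homo = fromℤ-*
    ; -‿homo = fromℤ-neg
    ; 0-homo = refl
    ; 1-homo = +-identityʳ 1#
    }

  private
    fromℤ-≟ : ∀ i j → Maybe.Maybe (fromℤ i ≈ fromℤ j)
    fromℤ-≟ i j = Maybe.map (λ { ≡.refl → refl }) (dec⇒weaklyDec ℤ._≟_ i j)

  open import Algebra.Solver.Ring ℤ.+-*-rawRing (fromCommutativeRing R) fromℤ-homomorphism fromℤ-≟ public

-- Stated over an arbitrary raw ring so that one set of formulas serves as ring elements, as
-- ring-solver syntax and in the graph of a homomorphism. On a commutative ring with numeral = num
-- they unfold to the formulas of the statement (covariant to G0 … G3, discriminant to disc).
module CubicFormulas {c ℓ} (M : RawRing c ℓ) (numeral : ℕ → RawRing.Carrier M) where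
  open RawRing M

  infix  10 _² _³
  infixl 6 _⊕_
  infixr 7 _⊛_

  _² _³ : Carrier → Carrier
  x ² = x * x
  x ³ = x * x * x

  private
    infixl 6 _-_
    _-_ : Carrier → Carrier → Carrier
    x - y = x + - y

  record BinaryCubic : Set c where
    constructor ⟨_,_,_,_⟩
    field c₀ c₁ c₂ c₃ : Carrier

  open BinaryCubic public

  _⊕_ : BinaryCubic → BinaryCubic → BinaryCubic
  f ⊕ g = ⟨ c₀ f + c₀ g , c₁ f + c₁ g , c₂ f + c₂ g , c₃ f + c₃ g ⟩

  _⊛_ : Carrier → BinaryCubic → BinaryCubic
  t ⊛ f = ⟨ t * c₀ f , t * c₁ f , t * c₂ f , t * c₃ f ⟩

  eval : BinaryCubic → Carrier → Carrier → Carrier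
  eval f x y = c₀ f * x ³ + c₁ f * x ² * y + c₂ f * x * y ² + c₃ f * y ³

  ∂X ∂Y : BinaryCubic → Carrier → Carrier → Carrier
  ∂X f x y = numeral 3 * c₀ f * x ² + numeral 2 * c₁ f * x * y + c₂ f * y ²
  ∂Y f x y = c₁ f * x ² + numeral 2 * c₂ f * x * y + numeral 3 * c₃ f * y ²

  polar : BinaryCubic → Carrier → Carrier → Carrier → Carrier → Carrier
  polar f x₁ y₁ x₂ y₂ = ∂X f x₁ y₁ * x₂ + ∂Y f x₁ y₁ * y₂

  -- f_XX f_YY - f_XY² = -4 (hessian 0F f X² + hessian 1F f XY + hessian 2F f Y²)
  hessian : Fin 3 → BinaryCubic → Carrier
  hessian 0F f = c₁ f ² - numeral 3 * c₀ f * c₂ f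
  hessian 1F f = c₁ f * c₂ f - numeral 9 * c₀ f * c₃ f
  hessian 2F f = c₂ f ² - numeral 3 * c₁ f * c₃ f

  mixedHessian : Fin 3 → BinaryCubic → BinaryCubic → Carrier
  mixedHessian 0F f g = numeral 2 * c₁ f * c₁ g - numeral 3 * (c₀ f * c₂ g + c₂ f * c₀ g)
  mixedHessian 1F f g = c₁ f * c₂ g + c₂ f * c₁ g - numeral 9 * (c₀ f * c₃ g + c₃ f * c₀ g)
  mixedHessian 2F f g = numeral 2 * c₂ f * c₂ g - numeral 3 * (c₁ f * c₃ g + c₃ f * c₁ g)

  discriminant : BinaryCubic → Carrier
  discriminant ⟨ a , b , c , d ⟩ =
    b ² * c ² - numeral 4 * a * c ³ - numeral 4 * b ³ * d
      - numeral 27 * a ² * d ² + numeral 18 * a * b * c * d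

  covariant : BinaryCubic → BinaryCubic
  covariant ⟨ a , b , c , d ⟩ =
    ⟨ numeral 2 * b ³ + numeral 27 * a ² * d - numeral 9 * a * b * c
    , numeral 3 * (b ² * c + numeral 9 * a * b * d - numeral 6 * a * c ²)
    , - (numeral 3 * (b * c ² + numeral 9 * a * c * d - numeral 6 * b ² * d))
    , - (numeral 2 * c ³ + numeral 27 * a * d ² - numeral 9 * b * c * d) ⟩

module BinaryCubicIdentities {r ℓ} (R : CommutativeRing r ℓ) where
  open CommutativeRing R
  open IntegerCoefficientSolver R
  open CubicFormulas rawRing (num R) public
  open import Relation.Binary.Reasoning.Setoid setoid

  private
    polynomialRawRing : ℕ → RawRing _ _
    polynomialRawRing n = record
      { Carrier = Polynomial n
      ; _≈_     = _≡_
      ; _+_     = _:+_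
      ; _*_     = _:*_
      ; -_      = :-_
      ; 0#      = con (+ 0)
      ; 1#      = con (+ 1)
      }

    lit : ∀ {n} → ℕ → Polynomial n
    lit k = con (+ k)

    module S {n} = CubicFormulas (polynomialRawRing n) lit

  HasVanishingHessian : BinaryCubic → Set ℓ
  HasVanishingHessian f = ∀ i → hessian i f ≈ 0#

  covariant-hessian : ∀ i f → hessian i (covariant f) ≈ num R 27 * discriminant f * hessian i f
  covariant-hessian 0F ⟨ a , b , c , d ⟩ =
    solve 4 (λ a b c d → let f = S.⟨ a , b , c , d ⟩ in
      S.hessian 0F (S.covariant f) := lit 27 :* S.discriminant f :* S.hessian 0F f) refl a b c d
  covariant-hessian 1F ⟨ a , b , c , d ⟩ =
    solve 4 (λ a b c d → let f = S.⟨ a , b , c , d ⟩ in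
      S.hessian 1F (S.covariant f) := lit 27 :* S.discriminant f :* S.hessian 1F f) refl a b c d
  covariant-hessian 2F ⟨ a , b , c , d ⟩ =
    solve 4 (λ a b c d → let f = S.⟨ a , b , c , d ⟩ in
      S.hessian 2F (S.covariant f) := lit 27 :* S.discriminant f :* S.hessian 2F f) refl a b c d

  covariant-mixedHessian : ∀ i f → mixedHessian i (covariant f) f ≈ 0#
  covariant-mixedHessian 0F ⟨ a , b , c , d ⟩ =
    solve 4 (λ a b c d → let f = S.⟨ a , b , c , d ⟩ in
      S.mixedHessian 0F (S.covariant f) f := lit 0) refl a b c d
  covariant-mixedHessian 1F ⟨ a , b , c , d ⟩ =
    solve 4 (λ a b c d → let f = S.⟨ a , b , c , d ⟩ in
      S.mixedHessian 1F (S.covariant f) f := lit 0) refl a b c d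
  covariant-mixedHessian 2F ⟨ a , b , c , d ⟩ =
    solve 4 (λ a b c d → let f = S.⟨ a , b , c , d ⟩ in
      S.mixedHessian 2F (S.covariant f) f := lit 0) refl a b c d

  hessian-⊕-⊛ : ∀ i f t g →
                hessian i (f ⊕ t ⊛ g) ≈ hessian i f + t * mixedHessian i f g + t ² * hessian i g
  hessian-⊕-⊛ 0F ⟨ a , b , c , d ⟩ t ⟨ a′ , b′ , c′ , d′ ⟩ =
    solve 9 (λ a b c d t a′ b′ c′ d′ → let f = S.⟨ a , b , c , d ⟩ ; g = S.⟨ a′ , b′ , c′ , d′ ⟩ in
      S.hessian 0F (f S.⊕ t S.⊛ g) := S.hessian 0F f :+ t :* S.mixedHessian 0F f g :+ t S.² :* S.hessian 0F g)
      refl a b c d t a′ b′ c′ d′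
  hessian-⊕-⊛ 1F ⟨ a , b , c , d ⟩ t ⟨ a′ , b′ , c′ , d′ ⟩ =
    solve 9 (λ a b c d t a′ b′ c′ d′ → let f = S.⟨ a , b , c , d ⟩ ; g = S.⟨ a′ , b′ , c′ , d′ ⟩ in
      S.hessian 1F (f S.⊕ t S.⊛ g) := S.hessian 1F f :+ t :* S.mixedHessian 1F f g :+ t S.² :* S.hessian 1F g)
      refl a b c d t a′ b′ c′ d′
  hessian-⊕-⊛ 2F ⟨ a , b , c , d ⟩ t ⟨ a′ , b′ , c′ , d′ ⟩ =
    solve 9 (λ a b c d t a′ b′ c′ d′ → let f = S.⟨ a , b , c , d ⟩ ; g = S.⟨ a′ , b′ , c′ , d′ ⟩ in
      S.hessian 2F (f S.⊕ t S.⊛ g) := S.hessian 2F f :+ t :* S.mixedHessian 2F f g :+ t S.² :* S.hessian 2F g)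
      refl a b c d t a′ b′ c′ d′

  hessian-⊛ : ∀ i t f → hessian i (t ⊛ f) ≈ t ² * hessian i f
  hessian-⊛ 0F t ⟨ a , b , c , d ⟩ =
    solve 5 (λ t a b c d → let f = S.⟨ a , b , c , d ⟩ in
      S.hessian 0F (t S.⊛ f) := t S.² :* S.hessian 0F f) refl t a b c d
  hessian-⊛ 1F t ⟨ a , b , c , d ⟩ =
    solve 5 (λ t a b c d → let f = S.⟨ a , b , c , d ⟩ in
      S.hessian 1F (t S.⊛ f) := t S.² :* S.hessian 1F f) refl t a b c d
  hessian-⊛ 2F t ⟨ a , b , c , d ⟩ =
    solve 5 (λ t a b c d → let f = S.⟨ a , b , c , d ⟩ in
      S.hessian 2F (t S.⊛ f) := t S.² :* S.hessian 2F f) refl t a b c d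

  hasVanishingHessian-⊛ : ∀ t f → HasVanishingHessian f → HasVanishingHessian (t ⊛ f)
  hasVanishingHessian-⊛ t f H i = trans (hessian-⊛ i t f) (trans (*-congˡ (H i)) (zeroʳ _))

  hasVanishingHessian-⊕-3δ⊛ : ∀ F g δ Δ → δ * δ ≈ - (num R 3 * Δ) →
    (∀ i → hessian i F ≈ num R 27 * Δ * hessian i g) → (∀ i → mixedHessian i F g ≈ 0#) →
    HasVanishingHessian (F ⊕ (num R 3 * δ) ⊛ g)
  hasVanishingHessian-⊕-3δ⊛ F g δ Δ δ²≈-3Δ hessianF≈27Δhessiang mixed≈0 i = begin
    hessian i (F ⊕ (num R 3 * δ) ⊛ g)
      ≈⟨ hessian-⊕-⊛ i F (num R 3 * δ) g ⟩
    hessian i F + num R 3 * δ * mixedHessian i F g + (num R 3 * δ) ² * hessian i g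
      ≈⟨ +-cong (+-cong (hessianF≈27Δhessiang i) (*-congˡ (mixed≈0 i))) (*-congʳ [3δ]²≈9δ²) ⟩
    num R 27 * Δ * h + num R 3 * δ * 0# + num R 9 * (δ * δ) * h
      ≈⟨ +-congˡ (*-congʳ (*-congˡ δ²≈-3Δ)) ⟩
    num R 27 * Δ * h + num R 3 * δ * 0# + num R 9 * - (num R 3 * Δ) * h
      ≈⟨ solve 3 (λ Δ δ h →
           lit 27 :* Δ :* h :+ lit 3 :* δ :* lit 0 :+ lit 9 :* :- (lit 3 :* Δ) :* h := lit 0) refl Δ δ h ⟩
    0# ∎
    where
    h = hessian i g
    [3δ]²≈9δ² : (num R 3 * δ) ² ≈ num R 9 * (δ * δ)
    [3δ]²≈9δ² = solve 1 (λ δ → (lit 3 :* δ) S.² := lit 9 :* (δ :* δ)) refl δ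

  private
    ≈-modulo-hessian : ∀ f → HasVanishingHessian f → ∀ {x y q₀ q₁ q₂} →
      x ≈ y + (q₀ * hessian 0F f + q₁ * hessian 1F f + q₂ * hessian 2F f) → x ≈ y
    ≈-modulo-hessian f H {x} {y} {q₀} {q₁} {q₂} x≈y+q·hessian = begin
      x
        ≈⟨ x≈y+q·hessian ⟩
      y + (q₀ * hessian 0F f + q₁ * hessian 1F f + q₂ * hessian 2F f)
        ≈⟨ +-congˡ (+-cong (+-cong (*-congˡ (H 0F)) (*-congˡ (H 1F))) (*-congˡ (H 2F))) ⟩
      y + (q₀ * 0# + q₁ * 0# + q₂ * 0#)
        ≈⟨ solve 4 (λ y q₀ q₁ q₂ → y :+ (q₀ :* lit 0 :+ q₁ :* lit 0 :+ q₂ :* lit 0) := y) refl y q₀ q₁ q₂ ⟩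
      y ∎

  -- Each identity holds modulo the Hessian coefficients; a certificate supplies the multipliers.
  module _ (f : BinaryCubic) (H : HasVanishingHessian f) (x y : Carrier) where

    eval²*c₀≈∂X³ : num R 27 * eval f x y ² * c₀ f ≈ ∂X f x y ³
    eval²*c₀≈∂X³ = ≈-modulo-hessian f H (certificate (c₀ f) (c₁ f) (c₂ f) (c₃ f) x y)
      where
      certificate = solve 6 (λ c₀ c₁ c₂ c₃ x y → let f = S.⟨ c₀ , c₁ , c₂ , c₃ ⟩ in
        lit 27 :* S.eval f x y S.² :* c₀ := S.∂X f x y S.³
          :+ ( :- (lit 18 :* c₃ :* x :* y :^ 5 :+ lit 12 :* c₂ :* x :^ 2 :* y :^ 4
                   :+ lit 8 :* c₁ :* x :^ 3 :* y :^ 3 :+ lit 9 :* c₀ :* x :^ 4 :* y :^ 2) :* S.hessian 0F f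
             :+ :- (lit 3 :* c₃ :* y :^ 6 :+ lit 6 :* c₀ :* x :^ 3 :* y :^ 3) :* S.hessian 1F f
             :+ :- (c₂ :* y :^ 6 :+ lit 6 :* c₁ :* x :* y :^ 5 :+ lit 18 :* c₀ :* x :^ 2 :* y :^ 4) :* S.hessian 2F f))
        refl

    eval²*c₁≈∂X²*∂Y : num R 27 * eval f x y ² * c₁ f ≈ num R 3 * ∂X f x y ² * ∂Y f x y
    eval²*c₁≈∂X²*∂Y = ≈-modulo-hessian f H (certificate (c₀ f) (c₁ f) (c₂ f) (c₃ f) x y)
      where
      certificate = solve 6 (λ c₀ c₁ c₂ c₃ x y → let f = S.⟨ c₀ , c₁ , c₂ , c₃ ⟩ in
        lit 27 :* S.eval f x y S.² :* c₁ := lit 3 :* S.∂X f x y S.² :* S.∂Y f x y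
          :+ ( (lit 18 :* c₃ :* x :^ 2 :* y :^ 4 :+ lit 18 :* c₂ :* x :^ 3 :* y :^ 3
                :+ lit 15 :* c₁ :* x :^ 4 :* y :^ 2 :+ lit 18 :* c₀ :* x :^ 5 :* y) :* S.hessian 0F f
             :+ lit 9 :* c₀ :* x :^ 4 :* y :^ 2 :* S.hessian 1F f
             :+ (lit 18 :* c₀ :* x :^ 3 :* y :^ 3 :- lit 9 :* c₃ :* y :^ 6 :- lit 6 :* c₂ :* x :* y :^ 5) :* S.hessian 2F f))
        refl

    eval²*c₂≈∂X*∂Y² : num R 27 * eval f x y ² * c₂ f ≈ num R 3 * ∂X f x y * ∂Y f x y ²
    eval²*c₂≈∂X*∂Y² = ≈-modulo-hessian f H (certificate (c₀ f) (c₁ f) (c₂ f) (c₃ f) x y)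
      where
      certificate = solve 6 (λ c₀ c₁ c₂ c₃ x y → let f = S.⟨ c₀ , c₁ , c₂ , c₃ ⟩ in
        lit 27 :* S.eval f x y S.² :* c₂ := lit 3 :* S.∂X f x y :* S.∂Y f x y S.²
          :+ ( (lit 18 :* c₃ :* x :^ 3 :* y :^ 3 :- lit 6 :* c₁ :* x :^ 5 :* y :- lit 9 :* c₀ :* x :^ 6) :* S.hessian 0F f
             :+ lit 9 :* c₃ :* x :^ 2 :* y :^ 4 :* S.hessian 1F f
             :+ (lit 18 :* c₃ :* x :* y :^ 5 :+ lit 15 :* c₂ :* x :^ 2 :* y :^ 4
                 :+ lit 18 :* c₁ :* x :^ 3 :* y :^ 3 :+ lit 18 :* c₀ :* x :^ 4 :* y :^ 2) :* S.hessian 2F f))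
        refl

    eval²*c₃≈∂Y³ : num R 27 * eval f x y ² * c₃ f ≈ ∂Y f x y ³
    eval²*c₃≈∂Y³ = ≈-modulo-hessian f H (certificate (c₀ f) (c₁ f) (c₂ f) (c₃ f) x y)
      where
      certificate = solve 6 (λ c₀ c₁ c₂ c₃ x y → let f = S.⟨ c₀ , c₁ , c₂ , c₃ ⟩ in
        lit 27 :* S.eval f x y S.² :* c₃ := S.∂Y f x y S.³
          :+ ( :- (lit 18 :* c₃ :* x :^ 4 :* y :^ 2 :+ lit 6 :* c₂ :* x :^ 5 :* y :+ c₁ :* x :^ 6) :* S.hessian 0F f
             :+ :- (lit 6 :* c₃ :* x :^ 3 :* y :^ 3 :+ lit 3 :* c₀ :* x :^ 6) :* S.hessian 1F f
             :+ :- (lit 9 :* c₃ :* x :^ 2 :* y :^ 4 :+ lit 8 :* c₂ :* x :^ 3 :* y :^ 3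
                    :+ lit 12 :* c₁ :* x :^ 4 :* y :^ 2 :+ lit 18 :* c₀ :* x :^ 5 :* y) :* S.hessian 2F f))
        refl

  cube-polar : ∀ f → HasVanishingHessian f → ∀ x₁ y₁ x₂ y₂ →
               num R 27 * (eval f x₁ y₁ ² * eval f x₂ y₂) ≈ polar f x₁ y₁ x₂ y₂ ³
  cube-polar f H x₁ y₁ x₂ y₂ = begin
    num R 27 * (E ² * eval f x₂ y₂)
      ≈⟨ distribute E (c₀ f) (c₁ f) (c₂ f) (c₃ f) x₂ y₂ ⟩
    num R 27 * E ² * c₀ f * x₂ ³ + num R 27 * E ² * c₁ f * (x₂ ² * y₂)
      + num R 27 * E ² * c₂ f * (x₂ * y₂ ²) + num R 27 * E ² * c₃ f * y₂ ³
      ≈⟨ +-cong (+-cong (+-cong (*-congʳ (eval²*c₀≈∂X³ f H x₁ y₁)) (*-congʳ (eval²*c₁≈∂X²*∂Y f H x₁ y₁)))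
                        (*-congʳ (eval²*c₂≈∂X*∂Y² f H x₁ y₁)))
                (*-congʳ (eval²*c₃≈∂Y³ f H x₁ y₁)) ⟩
    A ³ * x₂ ³ + num R 3 * A ² * B * (x₂ ² * y₂) + num R 3 * A * B ² * (x₂ * y₂ ²) + B ³ * y₂ ³
      ≈⟨ binomial A B x₂ y₂ ⟩
    polar f x₁ y₁ x₂ y₂ ³ ∎
    where
    E = eval f x₁ y₁
    A = ∂X f x₁ y₁
    B = ∂Y f x₁ y₁
    distribute = solve 7 (λ E c₀ c₁ c₂ c₃ x y → let 27E² = lit 27 :* E S.² in
      lit 27 :* (E S.² :* S.eval S.⟨ c₀ , c₁ , c₂ , c₃ ⟩ x y)
        := 27E² :* c₀ :* x S.³ :+ 27E² :* c₁ :* (x S.² :* y) :+ 27E² :* c₂ :* (x :* y S.²) :+ 27E² :* c₃ :* y S.³)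
      refl
    binomial = solve 4 (λ A B x y →
      A S.³ :* x S.³ :+ lit 3 :* A S.² :* B :* (x S.² :* y) :+ lit 3 :* A :* B S.² :* (x :* y S.²) :+ B S.³ :* y S.³
        := (A :* x :+ B :* y) S.³)
      refl

  divide-by-27 : ∀ {t u w} → num R 3 * t ≈ 1# → num R 27 * u ≈ w ³ → u ≈ (t * w) ³
  divide-by-27 {t} {u} {w} 3t≈1 27u≈w³ = begin
    u                     ≈⟨ *-identityˡ u ⟨
    1# * u                ≈⟨ *-congʳ [3t]³≈1 ⟨
    (num R 3 * t) ³ * u   ≈⟨ solve 2 (λ t u → (lit 3 :* t) S.³ :* u := t S.³ :* (lit 27 :* u)) refl t u ⟩
    t ³ * (num R 27 * u)  ≈⟨ *-congˡ 27u≈w³ ⟩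
    t ³ * w ³             ≈⟨ solve 2 (λ t w → t S.³ :* w S.³ := (t :* w) S.³) refl t w ⟩
    (t * w) ³             ∎
    where
    [3t]³≈1 : (num R 3 * t) ³ ≈ 1#
    [3t]³≈1 = trans (*-cong (*-cong 3t≈1 3t≈1) 3t≈1) (trans (*-identityʳ _) (*-identityʳ _))

-- A formula of CubicFormulas commutes with ι because it can be evaluated in the graph
-- of ι, whose points are pairs (x , y) with ι x ≈ y.
module GraphOfHomomorphism {k ℓk r ℓr} (K : CommutativeRing k ℓk) (R : CommutativeRing r ℓr)
  (ι : CommutativeRing.Carrier K → CommutativeRing.Carrier R)
  (hom : RingMorphisms.IsRingHomomorphism (CommutativeRing.rawRing K) (CommutativeRing.rawRing R) ι) where
  private
    module K = CommutativeRing K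
    module K′ = BinaryCubicIdentities K
    module R′ = BinaryCubicIdentities R
  open CommutativeRing R
  open RingMorphisms.IsRingHomomorphism hom

  ι-num : ∀ n → ι (num K n) ≈ num R n
  ι-num zero    = 0#-homo
  ι-num (suc n) = trans (+-homo _ _) (+-cong 1#-homo (ι-num n))

  private
    record GraphPoint : Set (k ⊔ r ⊔ ℓr) where
      field
        source          : K.Carrier
        target          : Carrier
        ι-source≈target : ι source ≈ target
    open GraphPoint

    graph : RawRing (k ⊔ r ⊔ ℓr) (ℓk ⊔ ℓr)
    graph = record
      { Carrier = GraphPoint
      ; _≈_     = λ p q → source p K.≈ source q × target p ≈ target q
      ; _+_     = λ p q → record
        { source          = source p K.+ source q
        ; target          = target p + target q
        ; ι-source≈target = trans (+-homo _ _) (+-cong (ι-source≈target p) (ι-source≈target q))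
        }
      ; _*_     = λ p q → record
        { source          = source p K.* source q
        ; target          = target p * target q
        ; ι-source≈target = trans (*-homo _ _) (*-cong (ι-source≈target p) (ι-source≈target q))
        }
      ; -_      = λ p → record
        { source          = K.- source p
        ; target          = - target p
        ; ι-source≈target = trans (-‿homo _) (-‿cong (ι-source≈target p))
        }
      ; 0#      = record { source = K.0# ; target = 0# ; ι-source≈target = 0#-homo }
      ; 1#      = record { source = K.1# ; target = 1# ; ι-source≈target = 1#-homo }
      }

    numeral : ℕ → GraphPoint
    numeral n = record { source = num K n ; target = num R n ; ι-source≈target = ι-num n }

    module Graph = CubicFormulas graph numeral

    embed : K.Carrier → GraphPoint
    embed x = record { source = x ; target = ι x ; ι-source≈target = refl }

    lift : K′.BinaryCubic → Graph.BinaryCubic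
    lift f = Graph.⟨ embed (K′.c₀ f) , embed (K′.c₁ f) , embed (K′.c₂ f) , embed (K′.c₃ f) ⟩

  map : K′.BinaryCubic → R′.BinaryCubic
  map f = R′.⟨ ι (K′.c₀ f) , ι (K′.c₁ f) , ι (K′.c₂ f) , ι (K′.c₃ f) ⟩

  ι-hessian : ∀ i f → ι (K′.hessian i f) ≈ R′.hessian i (map f)
  ι-hessian 0F f = ι-source≈target (Graph.hessian 0F (lift f))
  ι-hessian 1F f = ι-source≈target (Graph.hessian 1F (lift f))
  ι-hessian 2F f = ι-source≈target (Graph.hessian 2F (lift f))

  ι-mixedHessian : ∀ i f g → ι (K′.mixedHessian i f g) ≈ R′.mixedHessian i (map f) (map g)
  ι-mixedHessian 0F f g = ι-source≈target (Graph.mixedHessian 0F (lift f) (lift g))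
  ι-mixedHessian 1F f g = ι-source≈target (Graph.mixedHessian 1F (lift f) (lift g))
  ι-mixedHessian 2F f g = ι-source≈target (Graph.mixedHessian 2F (lift f) (lift g))

module CardanoCovariant {k ℓk r ℓr} (K : CommutativeRing k ℓk) (Kf : IsField K)
  (ch2 : ¬ (CommutativeRing._≈_ K (num K 2) (CommutativeRing.0# K)))
  (ch3 : ¬ (CommutativeRing._≈_ K (num K 3) (CommutativeRing.0# K)))
  (R : CommutativeRing r ℓr) (ι : CommutativeRing.Carrier K → CommutativeRing.Carrier R)
  (hom : RingMorphisms.IsRingHomomorphism (CommutativeRing.rawRing K) (CommutativeRing.rawRing R) ι)
  (δ : CommutativeRing.Carrier R) where
  private
    module K = CommutativeRing K
    module K′ = BinaryCubicIdentities K
    module ι = GraphOfHomomorphism K R ι hom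
  open CommutativeRing R
  open RingMorphisms.IsRingHomomorphism hom
  open BinaryCubicIdentities R
  open import Relation.Binary.Reasoning.Setoid setoid

  cardanoCubic : K′.BinaryCubic → BinaryCubic
  cardanoCubic g = ι (half K Kf R ι δ ch2) ⊛ (ι.map (K′.covariant g) ⊕ (num R 3 * δ) ⊛ ι.map g)

  cardano-hasVanishingHessian : ∀ g Δ → K′.discriminant g K.≈ Δ → δ * δ ≈ - (num R 3 * ι Δ) →
                                HasVanishingHessian (cardanoCubic g)
  cardano-hasVanishingHessian g Δ disc≈Δ δ²≈-3Δ =
    hasVanishingHessian-⊛ (ι (half K Kf R ι δ ch2)) _
      (hasVanishingHessian-⊕-3δ⊛ (ι.map (K′.covariant g)) (ι.map g) δ (ι Δ)
        δ²≈-3Δ hessian-covariant mixedHessian-covariant)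
    where
    hessian-covariant : ∀ i → hessian i (ι.map (K′.covariant g)) ≈ num R 27 * ι Δ * hessian i (ι.map g)
    hessian-covariant i = begin
      hessian i (ι.map (K′.covariant g))      ≈⟨ ι.ι-hessian i (K′.covariant g) ⟨
      ι (K′.hessian i (K′.covariant g))       ≈⟨ ⟦⟧-cong (K.trans (K′.covariant-hessian i g)
                                                                   (K.*-congʳ (K.*-congˡ disc≈Δ))) ⟩
      ι (num K 27 K.* Δ K.* K′.hessian i g)   ≈⟨ trans (*-homo _ _) (*-cong (trans (*-homo _ _) (*-congʳ (ι.ι-num 27)))
                                                                            (ι.ι-hessian i g)) ⟩
      num R 27 * ι Δ * hessian i (ι.map g)    ∎
    mixedHessian-covariant : ∀ i → mixedHessian i (ι.map (K′.covariant g)) (ι.map g) ≈ 0#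
    mixedHessian-covariant i = begin
      mixedHessian i (ι.map (K′.covariant g)) (ι.map g)  ≈⟨ ι.ι-mixedHessian i (K′.covariant g) g ⟨
      ι (K′.mixedHessian i (K′.covariant g) g)           ≈⟨ ⟦⟧-cong (K′.covariant-mixedHessian i g) ⟩
      ι K.0#                                             ≈⟨ 0#-homo ⟩
      0#                                                 ∎

  3*ι-third≈1 : num R 3 * ι (third K Kf R ι δ ch3) ≈ 1#
  3*ι-third≈1 = begin
    num R 3 * ι (third K Kf R ι δ ch3)   ≈⟨ trans (*-homo _ _) (*-congʳ (ι.ι-num 3)) ⟨
    ι (num K 3 K.* third K Kf R ι δ ch3) ≈⟨ ⟦⟧-cong (proj₂ (IsField.inv Kf (num K 3) ch3)) ⟩
    ι K.1#                               ≈⟨ 1#-homo ⟩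
    1#                                   ∎

proposition3p2 : {k ℓ r ℓr : Level} (K : CommutativeRing k ℓ) (Kf : IsField K)
    (ch2 : ¬ (CommutativeRing._≈_ K (num K 2) (CommutativeRing.0# K)))
    (ch3 : ¬ (CommutativeRing._≈_ K (num K 3) (CommutativeRing.0# K)))
    (Δ : CommutativeRing.Carrier K) → ¬ (CommutativeRing._≈_ K Δ (CommutativeRing.0# K)) →
    (a b c d : CommutativeRing.Carrier K) → CommutativeRing._≈_ K (disc K a b c d) Δ →
    (R : CommutativeRing r ℓr)
    (ι : CommutativeRing.Carrier K → CommutativeRing.Carrier R) →
    RingMorphisms.IsRingHomomorphism (CommutativeRing.rawRing K) (CommutativeRing.rawRing R) ι →
    (δ : CommutativeRing.Carrier R) →
    CommutativeRing._≈_ R (CommutativeRing._*_ R δ δ)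
      (CommutativeRing.-_ R (CommutativeRing._*_ R (num R 3) (ι Δ))) →
    (x1 y1 x2 y2 : CommutativeRing.Carrier R) →
    CommutativeRing._≈_ R
      (CommutativeRing._*_ R
        (sq R (cardano K Kf R ι δ ch2 a b c d x1 y1))
        (cardano K Kf R ι δ ch2 a b c d x2 y2))
      (cube R (Fform K Kf R ι δ ch2 ch3 a b c d x1 y1 x2 y2))
proposition3p2 K Kf ch2 ch3 Δ _ a b c d disc≈Δ R ι hom δ δ²≈-3Δ x1 y1 x2 y2 =
  divide-by-27 3*ι-third≈1 (cube-polar C (cardano-hasVanishingHessian g Δ disc≈Δ δ²≈-3Δ) x1 y1 x2 y2)
  where
  open BinaryCubicIdentities R
  open CardanoCovariant K Kf ch2 ch3 R ι hom δ
  module K′ = BinaryCubicIdentities K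
  g = K′.⟨ a , b , c , d ⟩
  C = cardanoCubic g
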